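{- Let $b\ge1$ and let $f:\{0,1\}^b\to\{0,1\}$ satisfy $f(0)=0$ and $f(e_i)=1$ for every standard basis vector $e_i$. Let $P_f$ be the multilinear polynomial representing $f$ and define the univariate polynomial $p_f(\mu):=P_f(\mu,\mu,\dots,\mu)$. Then (1) $\deg(p_f)\le\deg(f)$; (2) $\sup_{x\in[0,1]}|p_f(x)|\le1$; (3) $|p_f''(0)|\ge b(b-1)$.
   Context: $\deg(f)$ is the degree of the unique multilinear real polynomial $P_f$ agreeing with $f$ on $\{0,1\}^b$.
   Formalization: In conclusion (2), the bound on $|p_f(x)|$ is asserted only for rational x in $[0,1]$ instead of every real point of the interval. -}

module Defs where

open import Data.Bool using (Bool; true; false; if_then_else_)
open import Data.Nat as ℕ using (ℕ; zero; suc; _⊔_)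
open import Data.Fin using (Fin)
open import Data.Vec using (Vec; []; _∷_; replicate; _[_]≔_; map)
open import Data.List using (List; []; _∷_)
open import Data.Integer using (+_)
open import Data.Rational using (ℚ; 0ℚ; 1ℚ; _+_; _*_; _/_)
open import Data.Rational.Properties using (_≟_)
open import Relation.Nullary using (does)
open import Relation.Binary.PropositionalEquality using (_≡_)

-- Points of the Boolean cube {0,1}^b are 'Vec Bool b'; subsets S ⊆ [b]
-- (indexing multilinear monomials x_S = ∏_{i∈S} x_i) are also 'Vec Bool b'.

ℕ→ℚ : ℕ → ℚ
ℕ→ℚ n = + n / 1

B→ℚ : Bool → ℚ
B→ℚ true  = 1ℚ
B→ℚ false = 0ℚ

e : ∀ {b} → Fin b → Vec Bool b
e {b} i = replicate b false [ i ]≔ true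

card : ∀ {b} → Vec Bool b → ℕ
card []          = 0
card (true ∷ S)  = suc (card S)
card (false ∷ S) = card S

sumSubsets : ∀ {b} → (Vec Bool b → ℚ) → ℚ
sumSubsets {zero}  g = g []
sumSubsets {suc b} g = sumSubsets (λ S → g (false ∷ S)) + sumSubsets (λ S → g (true ∷ S))

maxSubsets : ∀ {b} → (Vec Bool b → ℕ) → ℕ
maxSubsets {zero}  g = g []
maxSubsets {suc b} g = maxSubsets (λ S → g (false ∷ S)) ⊔ maxSubsets (λ S → g (true ∷ S))

-- A real multilinear polynomial in b variables, given by its coefficients
-- c_S (one for each monomial x_S); coefficients are taken rational.
MultilinPoly : ℕ → Set
MultilinPoly b = Vec Bool b → ℚ

monomial : ∀ {b} → Vec Bool b → Vec ℚ b → ℚ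
monomial []          []       = 1ℚ
monomial (true ∷ S)  (x ∷ xs) = x * monomial S xs
monomial (false ∷ S) (x ∷ xs) = monomial S xs

evalML : ∀ {b} → MultilinPoly b → Vec ℚ b → ℚ
evalML P x = sumSubsets (λ S → P S * monomial S x)

Represents : ∀ {b} → MultilinPoly b → (Vec Bool b → Bool) → Set
Represents P f = ∀ x → evalML P (map B→ℚ x) ≡ B→ℚ (f x)

degML : ∀ {b} → MultilinPoly b → ℕ
degML P = maxSubsets (λ S → if does (P S ≟ 0ℚ) then 0 else card S)

diag : ∀ {b} → MultilinPoly b → ℚ → ℚ
diag {b} P μ = evalML P (replicate b μ)

-- Univariate polynomials as coefficient lists a₀ ∷ a₁ ∷ … (a_k of μ^k)
evalPoly : List ℚ → ℚ → ℚ
evalPoly []       μ = 0ℚ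
evalPoly (a ∷ as) μ = a + μ * evalPoly as μ

derivFrom : ℕ → List ℚ → List ℚ
derivFrom k []       = []
derivFrom k (a ∷ as) = (ℕ→ℚ k * a) ∷ derivFrom (suc k) as

deriv : List ℚ → List ℚ
deriv []       = []
deriv (a ∷ as) = derivFrom 1 as

module Submission where

-- Split off the first variable: P(y, x′) = P₀(x′) + y · ∂P(x′), where the slice P₀ interpolates
-- f(0, ·) and ∂P interpolates the difference f(1, ·) − f(0, ·).  On the cube [0,1]^b the value of P is a convex combination of
-- the values of P₀ and P₀ + ∂P, which gives (2).  The coefficient of μ^k in p_f is the sum of
-- the c_S with |S| = k; this gives (1), and since c_∅ = f(0) = 0, c_{i} = f(e_i) − f(0) = 1 and
-- c_{ij} = f(e_i + e_j) − f(e_i) − f(e_j) + f(0) ≤ −1, the coefficient of μ² is at most −C(b,2).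
-- That coefficient is p_f″(0)/2 for every coefficient list representing p_f, because a
-- polynomial vanishing on (0,1] has only zero coefficients; this gives (3).

open import Defs
open import Data.Bool using (Bool; true; false; if_then_else_; T)
open import Data.Fin using (Fin) renaming (zero to fzero; suc to fsuc)
open import Data.Integer as ℤ using (+_)
import Data.Integer.Properties as ℤₚ
open import Data.List using (List; []; _∷_)
import Data.List as List
open import Data.Nat as ℕ using (ℕ; zero; suc)
open import Data.Nat.Combinatorics using (_C_; nC1≡n; nCk+nC[k+1]≡[n+1]C[k+1])
import Data.Nat.Properties as ℕₚ
open import Data.Nat.Tactic.RingSolver as ℕ-Solver using ()
open import Data.Product using (_×_; Σ; _,_; proj₁; proj₂)
open import Data.Rational as ℚ
  using (ℚ; ∣_∣; 0ℚ; 1ℚ; _+_; _*_; -_; _-_; _≤_; _<_; 1/_; toℚᵘ; NonZero; Positive; NonNegative; positive; nonNegative)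
open import Data.Rational.Properties
open import Data.Rational.Solver using (module +-*-Solver)
open +-*-Solver using (solve; _:+_; _:*_; :-_; _:-_; _:=_; con)
open import Algebra.Properties.Group +-0-group using (⁻¹-involutive; inverseˡ-unique; x∙y⁻¹≈ε⇒x≈y)
import Data.Rational.Unnormalised as ℚᵘ
import Data.Rational.Unnormalised.Properties as ℚᵘ
open import Data.Sum using (inj₁; inj₂)
open import Data.Unit using (tt)
open import Data.Vec using (Vec; []; _∷_; replicate; toList; map)
open import Data.Vec.Relation.Unary.All using (All; []; _∷_)
open import Relation.Nullary using (¬_; yes; no; does; contradiction)
open import Relation.Binary.PropositionalEquality

ℕ→ℚ-+ : ∀ m n → ℕ→ℚ (m ℕ.+ n) ≡ ℕ→ℚ m + ℕ→ℚ n
ℕ→ℚ-+ m n = toℚᵘ-injective (begin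
  toℚᵘ (ℕ→ℚ (m ℕ.+ n))                       ≈⟨ toℚᵘ-fromℚᵘ (mkℚᵘ (m ℕ.+ n)) ⟩
  mkℚᵘ (m ℕ.+ n)                             ≈⟨ ℚᵘ.*≡* (cong (ℤ._* + 1) (sym identities)) ⟩
  mkℚᵘ m ℚᵘ.+ mkℚᵘ n                          ≈⟨ ℚᵘ.+-cong (toℚᵘ-fromℚᵘ (mkℚᵘ m)) (toℚᵘ-fromℚᵘ (mkℚᵘ n)) ⟨
  toℚᵘ (ℕ→ℚ m) ℚᵘ.+ toℚᵘ (ℕ→ℚ n)              ≈⟨ toℚᵘ-homo-+ (ℕ→ℚ m) (ℕ→ℚ n) ⟨
  toℚᵘ (ℕ→ℚ m + ℕ→ℚ n)                       ∎)
  where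
  open ℚᵘ.≃-Reasoning
  mkℚᵘ : ℕ → ℚᵘ.ℚᵘ
  mkℚᵘ k = ℚᵘ.mkℚᵘ (+ k) 0
  identities : + m ℤ.* + 1 ℤ.+ + n ℤ.* + 1 ≡ + m ℤ.+ + n
  identities = cong₂ ℤ._+_ (ℤₚ.*-identityʳ (+ m)) (ℤₚ.*-identityʳ (+ n))

p≤q⇒0≤q-p : ∀ {p q} → p ≤ q → 0ℚ ≤ q - p
p≤q⇒0≤q-p {p} {q} p≤q = ≤-trans (≤-reflexive (sym (+-inverseʳ p))) (+-monoˡ-≤ (- p) p≤q)

*-nonNeg : ∀ {p q} → 0ℚ ≤ p → 0ℚ ≤ q → 0ℚ ≤ p * q
*-nonNeg {p} {q} 0≤p 0≤q =
  nonNegative⁻¹ (p * q) {{nonNeg*nonNeg⇒nonNeg p {{nonNegative 0≤p}} q {{nonNegative 0≤q}}}}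

*-pos : ∀ {p q} → 0ℚ < p → 0ℚ < q → 0ℚ < p * q
*-pos {p} {q} 0<p 0<q = positive⁻¹ (p * q) {{pos*pos⇒pos p {{positive 0<p}} q {{positive 0<q}}}}

p≤∣p∣ : ∀ p → p ≤ ∣ p ∣
p≤∣p∣ p with ≤-total 0ℚ p
... | inj₁ 0≤p = ≤-reflexive (sym (0≤p⇒∣p∣≡p 0≤p))
... | inj₂ p≤0 = ≤-trans p≤0 (0≤∣p∣ p)

*-cancelˡ-≡0 : ∀ p {q} .{{_ : NonZero p}} → p * q ≡ 0ℚ → q ≡ 0ℚ
*-cancelˡ-≡0 p {q} pq≡0 = begin
  q               ≡⟨ *-identityˡ q ⟨
  1ℚ * q          ≡⟨ cong (_* q) (*-inverseˡ p) ⟨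
  (1/ p * p) * q  ≡⟨ *-assoc (1/ p) p q ⟩
  1/ p * (p * q)  ≡⟨ cong (_*_ (1/ p)) pq≡0 ⟩
  1/ p * 0ℚ       ≡⟨ *-zeroʳ (1/ p) ⟩
  0ℚ              ∎
  where open ≡-Reasoning

sumSubsets-cong : ∀ {b} {g h : Vec Bool b → ℚ} → (∀ S → g S ≡ h S) → sumSubsets g ≡ sumSubsets h
sumSubsets-cong {zero}  g≗h = g≗h []
sumSubsets-cong {suc b} g≗h =
  cong₂ _+_ (sumSubsets-cong (λ S → g≗h (false ∷ S))) (sumSubsets-cong (λ S → g≗h (true ∷ S)))

sumSubsets-zero : ∀ {b} {g : Vec Bool b → ℚ} → (∀ S → g S ≡ 0ℚ) → sumSubsets g ≡ 0ℚ
sumSubsets-zero {zero}  g≗0 = g≗0 []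
sumSubsets-zero {suc b} g≗0 =
  cong₂ _+_ (sumSubsets-zero (λ S → g≗0 (false ∷ S))) (sumSubsets-zero (λ S → g≗0 (true ∷ S)))

+-interchange : ∀ p q r s → (p + q) + (r + s) ≡ (p + r) + (q + s)
+-interchange = solve 4 (λ p q r s → (p :+ q) :+ (r :+ s) := (p :+ r) :+ (q :+ s)) refl

sumSubsets-+ : ∀ {b} (g h : Vec Bool b → ℚ) →
               sumSubsets (λ S → g S + h S) ≡ sumSubsets g + sumSubsets h
sumSubsets-+ {zero}  g h = refl
sumSubsets-+ {suc b} g h =
  trans (cong₂ _+_ (sumSubsets-+ g₀ h₀) (sumSubsets-+ g₁ h₁))
        (+-interchange (sumSubsets g₀) (sumSubsets h₀) (sumSubsets g₁) (sumSubsets h₁))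
  where
  g₀ g₁ h₀ h₁ : Vec Bool b → ℚ
  g₀ S = g (false ∷ S)
  g₁ S = g (true ∷ S)
  h₀ S = h (false ∷ S)
  h₁ S = h (true ∷ S)

sumSubsets-*ˡ : ∀ {b} c (g : Vec Bool b → ℚ) → sumSubsets (λ S → c * g S) ≡ c * sumSubsets g
sumSubsets-*ˡ {zero}  c g = refl
sumSubsets-*ˡ {suc b} c g = trans
  (cong₂ _+_ (sumSubsets-*ˡ c (λ S → g (false ∷ S))) (sumSubsets-*ˡ c (λ S → g (true ∷ S))))
  (sym (*-distribˡ-+ c _ _))

-- Splitting off the first variable

restrict₀ : ∀ {b} → MultilinPoly (suc b) → MultilinPoly b
restrict₀ P S = P (false ∷ S)

derivative₀ : ∀ {b} → MultilinPoly (suc b) → MultilinPoly b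
derivative₀ P S = P (true ∷ S)

restrict₁ : ∀ {b} → MultilinPoly (suc b) → MultilinPoly b
restrict₁ P S = restrict₀ P S + derivative₀ P S

evalML-∷ : ∀ {b} (P : MultilinPoly (suc b)) y ys →
           evalML P (y ∷ ys) ≡ evalML (restrict₀ P) ys + y * evalML (derivative₀ P) ys
evalML-∷ {b} P y ys = cong (_+_ (evalML (restrict₀ P) ys)) (begin
  sumSubsets (λ S → P (true ∷ S) * (y * monomial S ys))  ≡⟨ sumSubsets-cong reorder ⟩
  sumSubsets (λ S → y * term S)                          ≡⟨ sumSubsets-*ˡ y term ⟩
  y * evalML (derivative₀ P) ys                          ∎)
  where
  open ≡-Reasoning
  swap : ∀ p q r → p * (q * r) ≡ q * (p * r)
  swap = solve 3 (λ p q r → p :* (q :* r) := q :* (p :* r)) refl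
  term : Vec Bool b → ℚ
  term S = P (true ∷ S) * monomial S ys
  reorder : ∀ S → P (true ∷ S) * (y * monomial S ys) ≡ y * term S
  reorder S = swap (P (true ∷ S)) y (monomial S ys)

evalML-restrict₁ : ∀ {b} (P : MultilinPoly (suc b)) ys →
                   evalML (restrict₁ P) ys ≡ evalML (restrict₀ P) ys + evalML (derivative₀ P) ys
evalML-restrict₁ P ys = trans
  (sumSubsets-cong (λ S → *-distribʳ-+ (monomial S ys) (restrict₀ P S) (derivative₀ P S)))
  (sumSubsets-+ (λ S → restrict₀ P S * monomial S ys) (λ S → derivative₀ P S * monomial S ys))

evalML-0∷ : ∀ {b} (P : MultilinPoly (suc b)) ys → evalML P (0ℚ ∷ ys) ≡ evalML (restrict₀ P) ys
evalML-0∷ P ys = begin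
  evalML P (0ℚ ∷ ys)  ≡⟨ evalML-∷ P 0ℚ ys ⟩
  A + 0ℚ * D          ≡⟨ cong (_+_ A) (*-zeroˡ D) ⟩
  A + 0ℚ              ≡⟨ +-identityʳ A ⟩
  A                   ∎
  where
  open ≡-Reasoning
  A D : ℚ
  A = evalML (restrict₀ P) ys
  D = evalML (derivative₀ P) ys

evalML-1∷ : ∀ {b} (P : MultilinPoly (suc b)) ys → evalML P (1ℚ ∷ ys) ≡ evalML (restrict₁ P) ys
evalML-1∷ P ys = begin
  evalML P (1ℚ ∷ ys)       ≡⟨ evalML-∷ P 1ℚ ys ⟩
  A + 1ℚ * D               ≡⟨ cong (_+_ A) (*-identityˡ D) ⟩
  A + D                    ≡⟨ evalML-restrict₁ P ys ⟨
  evalML (restrict₁ P) ys  ∎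
  where
  open ≡-Reasoning
  A D : ℚ
  A = evalML (restrict₀ P) ys
  D = evalML (derivative₀ P) ys

evalML-derivative₀ : ∀ {b} (P : MultilinPoly (suc b)) ys →
                     evalML (derivative₀ P) ys ≡ evalML P (1ℚ ∷ ys) - evalML P (0ℚ ∷ ys)
evalML-derivative₀ P ys = begin
  D                                        ≡⟨ cancel A D ⟩
  (A + D) - A                              ≡⟨ cong (λ q → q - A) (evalML-restrict₁ P ys) ⟨
  evalML (restrict₁ P) ys - A              ≡⟨ cong₂ _-_ (evalML-1∷ P ys) (evalML-0∷ P ys) ⟨
  evalML P (1ℚ ∷ ys) - evalML P (0ℚ ∷ ys)  ∎
  where
  open ≡-Reasoning
  A D : ℚ
  A = evalML (restrict₀ P) ys
  D = evalML (derivative₀ P) ys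
  cancel : ∀ p q → q ≡ (p + q) - p
  cancel = solve 2 (λ p q → q := (p :+ q) :- p) refl

Interpolates : ∀ {b} → MultilinPoly b → (Vec Bool b → ℚ) → Set
Interpolates P h = ∀ x → evalML P (map B→ℚ x) ≡ h x

module _ {b} (P : MultilinPoly (suc b)) {h : Vec Bool (suc b) → ℚ} (P≈h : Interpolates P h) where

  interpolates-restrict₀ : Interpolates (restrict₀ P) (λ x → h (false ∷ x))
  interpolates-restrict₀ x = trans (sym (evalML-0∷ P (map B→ℚ x))) (P≈h (false ∷ x))

  interpolates-restrict₁ : Interpolates (restrict₁ P) (λ x → h (true ∷ x))
  interpolates-restrict₁ x = trans (sym (evalML-1∷ P (map B→ℚ x))) (P≈h (true ∷ x))

  interpolates-derivative₀ : Interpolates (derivative₀ P) (λ x → h (true ∷ x) - h (false ∷ x))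
  interpolates-derivative₀ x =
    trans (evalML-derivative₀ P (map B→ℚ x)) (cong₂ _-_ (P≈h (true ∷ x)) (P≈h (false ∷ x)))

-- Values on the unit cube

infix 4 _∈[0,1]

_∈[0,1] : ℚ → Set
p ∈[0,1] = 0ℚ ≤ p × p ≤ 1ℚ

replicate⁺ : ∀ {A : Set} {Q : A → Set} n {x} → Q x → All Q (replicate n x)
replicate⁺ zero    Qx = []
replicate⁺ (suc n) Qx = Qx ∷ replicate⁺ n Qx

B→ℚ-∈[0,1] : ∀ c → B→ℚ c ∈[0,1]
B→ℚ-∈[0,1] true  = <⇒≤ (positive⁻¹ 1ℚ) , ≤-refl
B→ℚ-∈[0,1] false = ≤-refl , <⇒≤ (positive⁻¹ 1ℚ)

convex-∈[0,1] : ∀ {p d y} → y ∈[0,1] → p ∈[0,1] → p + d ∈[0,1] → p + y * d ∈[0,1]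
convex-∈[0,1] {p} {d} {y} (0≤y , y≤1) (0≤p , p≤1) (0≤p+d , p+d≤1) =
  subst _∈[0,1] (sym (convex p d y)) (lower , upper)
  where
  0≤1-y : 0ℚ ≤ 1ℚ - y
  0≤1-y = p≤q⇒0≤q-p y≤1
  instance
    1-y-nonNeg : NonNegative (1ℚ - y)
    1-y-nonNeg = nonNegative 0≤1-y
    y-nonNeg : NonNegative y
    y-nonNeg = nonNegative 0≤y
  convex : ∀ p d y → p + y * d ≡ (1ℚ - y) * p + y * (p + d)
  convex = solve 3 (λ p d y → p :+ y :* d := (con 1ℚ :- y) :* p :+ y :* (p :+ d)) refl
  partition : ∀ y → (1ℚ - y) * 1ℚ + y * 1ℚ ≡ 1ℚ
  partition = solve 1 (λ y → (con 1ℚ :- y) :* con 1ℚ :+ y :* con 1ℚ := con 1ℚ) refl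
  lower : 0ℚ ≤ (1ℚ - y) * p + y * (p + d)
  lower = +-mono-≤ (*-nonNeg 0≤1-y 0≤p) (*-nonNeg 0≤y 0≤p+d)
  upper : (1ℚ - y) * p + y * (p + d) ≤ 1ℚ
  upper = ≤-trans (+-mono-≤ (*-monoˡ-≤-nonNeg (1ℚ - y) p≤1) (*-monoˡ-≤-nonNeg y p+d≤1))
                  (≤-reflexive (partition y))

evalML-∈[0,1] : ∀ {b} {P : MultilinPoly b} {h} → Interpolates P h → (∀ x → h x ∈[0,1]) →
                ∀ {ys} → All _∈[0,1] ys → evalML P ys ∈[0,1]
evalML-∈[0,1] {zero}  P≈h h∈ []           = subst _∈[0,1] (sym (P≈h [])) (h∈ [])
evalML-∈[0,1] {suc b} {P} P≈h h∈ {y ∷ ys} (y∈ ∷ ys∈) =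
  subst _∈[0,1] (sym (evalML-∷ P y ys)) (convex-∈[0,1] y∈ slice₀∈ sum∈)
  where
  slice₀∈ : evalML (restrict₀ P) ys ∈[0,1]
  slice₀∈ = evalML-∈[0,1] {P = restrict₀ P} (interpolates-restrict₀ P P≈h) (λ x → h∈ (false ∷ x)) ys∈
  slice₁∈ : evalML (restrict₁ P) ys ∈[0,1]
  slice₁∈ = evalML-∈[0,1] {P = restrict₁ P} (interpolates-restrict₁ P P≈h) (λ x → h∈ (true ∷ x)) ys∈
  sum∈ : evalML (restrict₀ P) ys + evalML (derivative₀ P) ys ∈[0,1]
  sum∈ = subst _∈[0,1] (evalML-restrict₁ P ys) slice₁∈

-- Coefficient lists

coeff : List ℚ → ℕ → ℚ
coeff []       k       = 0ℚ
coeff (a ∷ as) zero    = a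
coeff (a ∷ as) (suc k) = coeff as k

infixl 6 _+ₚ_

_+ₚ_ : List ℚ → List ℚ → List ℚ
[]       +ₚ cs       = cs
(a ∷ as) +ₚ []       = a ∷ as
(a ∷ as) +ₚ (c ∷ cs) = (a + c) ∷ (as +ₚ cs)

evalPoly-+ₚ : ∀ as cs μ → evalPoly (as +ₚ cs) μ ≡ evalPoly as μ + evalPoly cs μ
evalPoly-+ₚ []       cs       μ = sym (+-identityˡ _)
evalPoly-+ₚ (a ∷ as) []       μ = sym (+-identityʳ _)
evalPoly-+ₚ (a ∷ as) (c ∷ cs) μ = begin
  (a + c) + μ * evalPoly (as +ₚ cs) μ                ≡⟨ cong (λ v → (a + c) + μ * v) (evalPoly-+ₚ as cs μ) ⟩
  (a + c) + μ * (evalPoly as μ + evalPoly cs μ)      ≡⟨ distrib a c μ (evalPoly as μ) (evalPoly cs μ) ⟩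
  (a + μ * evalPoly as μ) + (c + μ * evalPoly cs μ)  ∎
  where
  open ≡-Reasoning
  distrib : ∀ a c μ p q → (a + c) + μ * (p + q) ≡ (a + μ * p) + (c + μ * q)
  distrib = solve 5 (λ a c μ p q → (a :+ c) :+ μ :* (p :+ q) := (a :+ μ :* p) :+ (c :+ μ :* q)) refl

coeff-+ₚ : ∀ as cs k → coeff (as +ₚ cs) k ≡ coeff as k + coeff cs k
coeff-+ₚ []       cs       k       = sym (+-identityˡ _)
coeff-+ₚ (a ∷ as) []       k       = sym (+-identityʳ _)
coeff-+ₚ (a ∷ as) (c ∷ cs) zero    = refl
coeff-+ₚ (a ∷ as) (c ∷ cs) (suc k) = coeff-+ₚ as cs k

evalPoly-coeff≡0 : ∀ as μ → (∀ k → coeff as k ≡ 0ℚ) → evalPoly as μ ≡ 0ℚ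
evalPoly-coeff≡0 []       μ as≡0 = refl
evalPoly-coeff≡0 (a ∷ as) μ as≡0 = begin
  a + μ * evalPoly as μ  ≡⟨ cong₂ (λ u v → u + μ * v) (as≡0 0) tail≡0 ⟩
  0ℚ + μ * 0ℚ            ≡⟨ trans (+-identityˡ _) (*-zeroʳ μ) ⟩
  0ℚ                     ∎
  where
  open ≡-Reasoning
  tail≡0 : evalPoly as μ ≡ 0ℚ
  tail≡0 = evalPoly-coeff≡0 as μ (λ k → as≡0 (suc k))

truncate : (n : ℕ) → List ℚ → Vec ℚ n
truncate zero    as       = []
truncate (suc n) []       = 0ℚ ∷ truncate n []
truncate (suc n) (a ∷ as) = a ∷ truncate n as

evalPoly-truncate : ∀ n as μ → (∀ k → n ℕ.≤ k → coeff as k ≡ 0ℚ) →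
                    evalPoly as μ ≡ evalPoly (toList (truncate n as)) μ
evalPoly-truncate zero    as       μ vanish = evalPoly-coeff≡0 as μ (λ k → vanish k ℕ.z≤n)
evalPoly-truncate (suc n) []       μ vanish = begin
  0ℚ                                            ≡⟨ trans (sym (*-zeroʳ μ)) (sym (+-identityˡ _)) ⟩
  0ℚ + μ * 0ℚ                                   ≡⟨ cong (λ v → 0ℚ + μ * v) zeros ⟩
  0ℚ + μ * evalPoly (toList (truncate n [])) μ  ∎
  where
  open ≡-Reasoning
  zeros : 0ℚ ≡ evalPoly (toList (truncate n [])) μ
  zeros = evalPoly-truncate n [] μ (λ _ _ → refl)
evalPoly-truncate (suc n) (a ∷ as) μ vanish =
  cong (λ v → a + μ * v) (evalPoly-truncate n as μ (λ k n≤k → vanish (suc k) (ℕ.s≤s n≤k)))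

diagCoeffs : ∀ {b} → MultilinPoly b → List ℚ
diagCoeffs {zero}  P = P [] ∷ []
diagCoeffs {suc b} P = diagCoeffs (restrict₀ P) +ₚ (0ℚ ∷ diagCoeffs (derivative₀ P))

diag≡evalPoly-diagCoeffs : ∀ {b} (P : MultilinPoly b) μ → diag P μ ≡ evalPoly (diagCoeffs P) μ
diag≡evalPoly-diagCoeffs {zero} P μ = begin
  P [] * 1ℚ     ≡⟨ *-identityʳ (P []) ⟩
  P []          ≡⟨ trans (sym (+-identityʳ (P []))) (cong (_+_ (P [])) (sym (*-zeroʳ μ))) ⟩
  P [] + μ * 0ℚ ∎
  where open ≡-Reasoning
diag≡evalPoly-diagCoeffs {suc b} P μ = begin
  diag P μ                                           ≡⟨ evalML-∷ P μ (replicate b μ) ⟩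
  diag (restrict₀ P) μ + μ * diag (derivative₀ P) μ  ≡⟨ cong₂ (λ u v → u + μ * v) ih₀ ih∂ ⟩
  evalPoly P₀ μ + μ * evalPoly P∂ μ                  ≡⟨ cong (_+_ (evalPoly P₀ μ)) (+-identityˡ _) ⟨
  evalPoly P₀ μ + evalPoly (0ℚ ∷ P∂) μ               ≡⟨ evalPoly-+ₚ P₀ (0ℚ ∷ P∂) μ ⟨
  evalPoly (diagCoeffs P) μ                          ∎
  where
  open ≡-Reasoning
  P₀ P∂ : List ℚ
  P₀ = diagCoeffs (restrict₀ P)
  P∂ = diagCoeffs (derivative₀ P)
  ih₀ : diag (restrict₀ P) μ ≡ evalPoly P₀ μ
  ih₀ = diag≡evalPoly-diagCoeffs (restrict₀ P) μ
  ih∂ : diag (derivative₀ P) μ ≡ evalPoly P∂ μ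
  ih∂ = diag≡evalPoly-diagCoeffs (derivative₀ P) μ

-- Since card (true ∷ S) = suc (card S), levelSum (suc k) P reduces to
-- levelSum (suc k) (restrict₀ P) + levelSum k (derivative₀ P).
levelSum : ∀ {b} → ℕ → MultilinPoly b → ℚ
levelSum k P = sumSubsets (λ S → if card S ℕ.≡ᵇ k then P S else 0ℚ)

coeff-diagCoeffs : ∀ {b} (P : MultilinPoly b) k → coeff (diagCoeffs P) k ≡ levelSum k P
coeff-diagCoeffs {zero}  P zero    = refl
coeff-diagCoeffs {zero}  P (suc k) = refl
coeff-diagCoeffs {suc b} P k = begin
  coeff (diagCoeffs P) k          ≡⟨ coeff-+ₚ P₀ (0ℚ ∷ P∂) k ⟩
  coeff P₀ k + coeff (0ℚ ∷ P∂) k  ≡⟨ cong₂ _+_ (coeff-diagCoeffs (restrict₀ P) k) (shifted k) ⟩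
  levelSum k P                    ∎
  where
  open ≡-Reasoning
  P₀ P∂ : List ℚ
  P₀ = diagCoeffs (restrict₀ P)
  P∂ = diagCoeffs (derivative₀ P)
  shifted : ∀ k → coeff (0ℚ ∷ P∂) k ≡
                   sumSubsets (λ S → if suc (card S) ℕ.≡ᵇ k then derivative₀ P S else 0ℚ)
  shifted zero    = sym (sumSubsets-zero {b} (λ S → refl))
  shifted (suc k) = coeff-diagCoeffs (derivative₀ P) k

maxSubsets-≥ : ∀ {b} (g : Vec Bool b → ℕ) S → g S ℕ.≤ maxSubsets g
maxSubsets-≥ {zero}  g []          = ℕₚ.≤-refl
maxSubsets-≥ {suc b} g (false ∷ S) = ℕₚ.≤-trans (maxSubsets-≥ (λ S → g (false ∷ S)) S) (ℕₚ.m≤m⊔n _ _)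
maxSubsets-≥ {suc b} g (true ∷ S)  = ℕₚ.≤-trans (maxSubsets-≥ (λ S → g (true ∷ S)) S) (ℕₚ.m≤n⊔m _ _)

card≤degML : ∀ {b} (P : MultilinPoly b) S → P S ≢ 0ℚ → card S ℕ.≤ degML P
card≤degML P S PS≢0 = ℕₚ.≤-trans (ℕₚ.≤-reflexive card≡) (maxSubsets-≥ _ S)
  where
  card≡ : card S ≡ (if does (P S ≟ 0ℚ) then 0 else card S)
  card≡ with P S ≟ 0ℚ
  ... | yes PS≡0 = contradiction PS≡0 PS≢0
  ... | no  _    = refl

levelSum-vanishes : ∀ {b} (P : MultilinPoly b) k → degML P ℕ.< k → levelSum k P ≡ 0ℚ
levelSum-vanishes P k deg<k = sumSubsets-zero term
  where
  term : ∀ S → (if card S ℕ.≡ᵇ k then P S else 0ℚ) ≡ 0ℚ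
  term S with card S ℕ.≡ᵇ k in card≡ᵇk | P S ≟ 0ℚ
  ... | false | _        = refl
  ... | true  | yes PS≡0 = PS≡0
  ... | true  | no PS≢0  = contradiction (ℕₚ.≤-<-trans (card≤degML P S PS≢0) deg<k) (ℕₚ.<-irrefl card≡k)
    where
    card≡k : card S ≡ k
    card≡k = ℕₚ.≡ᵇ⇒≡ (card S) k (subst T (sym card≡ᵇk) tt)

diag-degree : ∀ {b} (P : MultilinPoly b) →
              Σ (Vec ℚ (suc (degML P))) (λ a → ∀ μ → diag P μ ≡ evalPoly (toList a) μ)
diag-degree P = truncate (suc (degML P)) (diagCoeffs P) , λ μ → trans
  (diag≡evalPoly-diagCoeffs P μ)
  (evalPoly-truncate (suc (degML P)) (diagCoeffs P) μ
    (λ k deg<k → trans (coeff-diagCoeffs P k) (levelSum-vanishes P k deg<k)))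

-- Uniqueness of coefficients

∥_∥₁ : List ℚ → ℚ
∥ []     ∥₁ = 0ℚ
∥ a ∷ as ∥₁ = ∣ a ∣ + ∥ as ∥₁

∥∥₁-nonNeg : ∀ as → 0ℚ ≤ ∥ as ∥₁
∥∥₁-nonNeg []       = ≤-refl
∥∥₁-nonNeg (a ∷ as) = +-mono-≤ (0≤∣p∣ a) (∥∥₁-nonNeg as)

∣evalPoly∣≤∥∥₁ : ∀ as {μ} → 0ℚ ≤ μ → μ ≤ 1ℚ → ∣ evalPoly as μ ∣ ≤ ∥ as ∥₁
∣evalPoly∣≤∥∥₁ []       _   _   = ≤-refl
∣evalPoly∣≤∥∥₁ (a ∷ as) {μ} 0≤μ μ≤1 = begin
  ∣ a + μ * v ∣          ≤⟨ ∣p+q∣≤∣p∣+∣q∣ a (μ * v) ⟩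
  ∣ a ∣ + ∣ μ * v ∣      ≡⟨ cong (_+_ ∣ a ∣) (∣p*q∣≡∣p∣*∣q∣ μ v) ⟩
  ∣ a ∣ + ∣ μ ∣ * ∣ v ∣  ≤⟨ +-monoʳ-≤ ∣ a ∣ (*-monoʳ-≤-nonNeg ∣ v ∣ {{∣-∣-nonNeg v}} ∣μ∣≤1) ⟩
  ∣ a ∣ + 1ℚ * ∣ v ∣     ≡⟨ cong (_+_ ∣ a ∣) (*-identityˡ ∣ v ∣) ⟩
  ∣ a ∣ + ∣ v ∣          ≤⟨ +-monoʳ-≤ ∣ a ∣ (∣evalPoly∣≤∥∥₁ as 0≤μ μ≤1) ⟩
  ∣ a ∣ + ∥ as ∥₁        ∎
  where
  open ≤-Reasoning
  v : ℚ
  v = evalPoly as μ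
  ∣μ∣≤1 : ∣ μ ∣ ≤ 1ℚ
  ∣μ∣≤1 = ≤-trans (≤-reflexive (0≤p⇒∣p∣≡p 0≤μ)) μ≤1

≤-infinitesimal⇒≡0 : ∀ {a s} → 0ℚ ≤ a → 0ℚ ≤ s → (∀ μ → 0ℚ < μ → μ ≤ 1ℚ → a ≤ μ * s) → a ≡ 0ℚ
≤-infinitesimal⇒≡0 {a} {s} 0≤a 0≤s a≤μs = ≤-antisym (≮⇒≥ 0≮a) 0≤a
  where
  0≮a : ¬ (0ℚ < a)
  0≮a 0<a = <-irrefl refl (≤-<-trans (a≤μs μ 0<μ μ≤1) μs<a)
    where
    -- μ := a / (a + s) lies in (0,1] and satisfies μ·s = a − μ·a < a.
    instance
      a+s-pos : Positive (a + s)
      a+s-pos = positive (+-mono-<-≤ 0<a 0≤s)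
      a+s-nonZero : NonZero (a + s)
      a+s-nonZero = pos⇒nonZero (a + s)
      1/[a+s]-pos : Positive (1/ (a + s))
      1/[a+s]-pos = 1/pos⇒pos (a + s)
      1/[a+s]-nonNeg : NonNegative (1/ (a + s))
      1/[a+s]-nonNeg = pos⇒nonNeg (1/ (a + s))
    μ : ℚ
    μ = a * 1/ (a + s)
    0<μ : 0ℚ < μ
    0<μ = *-pos 0<a (positive⁻¹ (1/ (a + s)))
    μ≤1 : μ ≤ 1ℚ
    μ≤1 = begin
      a * 1/ (a + s)        ≤⟨ *-monoʳ-≤-nonNeg (1/ (a + s)) a≤a+s ⟩
      (a + s) * 1/ (a + s)  ≡⟨ *-inverseʳ (a + s) ⟩
      1ℚ                    ∎
      where
      open ≤-Reasoning
      a≤a+s : a ≤ a + s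
      a≤a+s = ≤-trans (≤-reflexive (sym (+-identityʳ a))) (+-monoʳ-≤ a 0≤s)
    μs<a : μ * s < a
    μs<a = begin-strict
      μ * s                 ≡⟨ +-identityˡ (μ * s) ⟨
      0ℚ + μ * s            <⟨ +-monoˡ-< (μ * s) (*-pos 0<μ 0<a) ⟩
      μ * a + μ * s         ≡⟨ *-distribˡ-+ μ a s ⟨
      μ * (a + s)           ≡⟨ *-assoc a (1/ (a + s)) (a + s) ⟩
      a * (1/ (a + s) * (a + s)) ≡⟨ cong (_*_ a) (*-inverseˡ (a + s)) ⟩
      a * 1ℚ                ≡⟨ *-identityʳ a ⟩
      a                     ∎
      where open ≤-Reasoning

constant-coeff≡0 : ∀ a as → (∀ μ → 0ℚ < μ → μ ≤ 1ℚ → a + μ * evalPoly as μ ≡ 0ℚ) → a ≡ 0ℚ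
constant-coeff≡0 a as vanish =
  ∣p∣≡0⇒p≡0 a (≤-infinitesimal⇒≡0 (0≤∣p∣ a) (∥∥₁-nonNeg as) ∣a∣≤μ∥as∥₁)
  where
  ∣a∣≤μ∥as∥₁ : ∀ μ → 0ℚ < μ → μ ≤ 1ℚ → ∣ a ∣ ≤ μ * ∥ as ∥₁
  ∣a∣≤μ∥as∥₁ μ 0<μ μ≤1 = begin
    ∣ a ∣          ≡⟨ cong ∣_∣ (inverseˡ-unique a (μ * v) (vanish μ 0<μ μ≤1)) ⟩
    ∣ - (μ * v) ∣  ≡⟨ ∣-p∣≡∣p∣ (μ * v) ⟩
    ∣ μ * v ∣      ≡⟨ ∣p*q∣≡∣p∣*∣q∣ μ v ⟩
    ∣ μ ∣ * ∣ v ∣  ≡⟨ cong (_* ∣ v ∣) (0≤p⇒∣p∣≡p 0≤μ) ⟩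
    μ * ∣ v ∣      ≤⟨ *-monoˡ-≤-nonNeg μ {{nonNegative 0≤μ}} (∣evalPoly∣≤∥∥₁ as 0≤μ μ≤1) ⟩
    μ * ∥ as ∥₁    ∎
    where
    open ≤-Reasoning
    v : ℚ
    v = evalPoly as μ
    0≤μ : 0ℚ ≤ μ
    0≤μ = <⇒≤ 0<μ

vanishing⇒coeff≡0 : ∀ as → (∀ μ → 0ℚ < μ → μ ≤ 1ℚ → evalPoly as μ ≡ 0ℚ) → ∀ k → coeff as k ≡ 0ℚ
vanishing⇒coeff≡0 []       vanish k       = refl
vanishing⇒coeff≡0 (a ∷ as) vanish zero    = constant-coeff≡0 a as vanish
vanishing⇒coeff≡0 (a ∷ as) vanish (suc k) = vanishing⇒coeff≡0 as tail-vanishes k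
  where
  tail-vanishes : ∀ μ → 0ℚ < μ → μ ≤ 1ℚ → evalPoly as μ ≡ 0ℚ
  tail-vanishes μ 0<μ μ≤1 = *-cancelˡ-≡0 μ {{pos⇒nonZero μ {{positive 0<μ}}}} (begin
    μ * evalPoly as μ       ≡⟨ +-identityˡ _ ⟨
    0ℚ + μ * evalPoly as μ  ≡⟨ cong (λ c → c + μ * evalPoly as μ) (constant-coeff≡0 a as vanish) ⟨
    a + μ * evalPoly as μ   ≡⟨ vanish μ 0<μ μ≤1 ⟩
    0ℚ                      ∎)
    where open ≡-Reasoning

negₚ : List ℚ → List ℚ
negₚ = List.map (λ a → - a)

evalPoly-negₚ : ∀ as μ → evalPoly (negₚ as) μ ≡ - evalPoly as μ
evalPoly-negₚ []       μ = refl
evalPoly-negₚ (a ∷ as) μ = begin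
  - a + μ * evalPoly (negₚ as) μ  ≡⟨ cong (λ v → - a + μ * v) (evalPoly-negₚ as μ) ⟩
  - a + μ * - evalPoly as μ       ≡⟨ negate a μ (evalPoly as μ) ⟩
  - (a + μ * evalPoly as μ)       ∎
  where
  open ≡-Reasoning
  negate : ∀ a μ v → - a + μ * - v ≡ - (a + μ * v)
  negate = solve 3 (λ a μ v → (:- a) :+ μ :* (:- v) := :- (a :+ μ :* v)) refl

coeff-negₚ : ∀ as k → coeff (negₚ as) k ≡ - coeff as k
coeff-negₚ []       k       = refl
coeff-negₚ (a ∷ as) zero    = refl
coeff-negₚ (a ∷ as) (suc k) = coeff-negₚ as k

coeff-unique : ∀ as cs → (∀ μ → evalPoly as μ ≡ evalPoly cs μ) → ∀ k → coeff as k ≡ coeff cs k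
coeff-unique as cs as≗cs k = x∙y⁻¹≈ε⇒x≈y (coeff as k) (coeff cs k) (begin
  coeff as k - coeff cs k           ≡⟨ cong (_+_ (coeff as k)) (coeff-negₚ cs k) ⟨
  coeff as k + coeff (negₚ cs) k    ≡⟨ coeff-+ₚ as (negₚ cs) k ⟨
  coeff (as +ₚ negₚ cs) k           ≡⟨ vanishing⇒coeff≡0 (as +ₚ negₚ cs) difference-vanishes k ⟩
  0ℚ                                ∎)
  where
  open ≡-Reasoning
  difference-vanishes : ∀ μ → 0ℚ < μ → μ ≤ 1ℚ → evalPoly (as +ₚ negₚ cs) μ ≡ 0ℚ
  difference-vanishes μ _ _ = begin
    evalPoly (as +ₚ negₚ cs) μ             ≡⟨ evalPoly-+ₚ as (negₚ cs) μ ⟩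
    evalPoly as μ + evalPoly (negₚ cs) μ   ≡⟨ cong₂ _+_ (as≗cs μ) (evalPoly-negₚ cs μ) ⟩
    evalPoly cs μ - evalPoly cs μ          ≡⟨ +-inverseʳ (evalPoly cs μ) ⟩
    0ℚ                                     ∎

-- Low-degree coefficients

nC2-suc : ∀ n → suc n C 2 ≡ n ℕ.+ n C 2
nC2-suc n = trans (sym (nCk+nC[k+1]≡[n+1]C[k+1] n 1)) (cong (ℕ._+ n C 2) (nC1≡n n))

levelSum-0 : ∀ {b} (P : MultilinPoly b) {h} → Interpolates P h → levelSum 0 P ≡ h (replicate b false)
levelSum-0 {zero}  P P≈h = trans (sym (*-identityʳ (P []))) (P≈h [])
levelSum-0 {suc b} P {h} P≈h = begin
  levelSum 0 P                   ≡⟨⟩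
  L₀ + sumSubsets {b} (λ _ → 0ℚ)  ≡⟨ cong (_+_ L₀) (sumSubsets-zero {b} (λ _ → refl)) ⟩
  L₀ + 0ℚ                        ≡⟨ +-identityʳ L₀ ⟩
  L₀                             ≡⟨ levelSum-0 (restrict₀ P) (interpolates-restrict₀ P P≈h) ⟩
  h (replicate (suc b) false)    ∎
  where
  open ≡-Reasoning
  L₀ : ℚ
  L₀ = levelSum 0 (restrict₀ P)

levelSum-1-≤ : ∀ {b} (P : MultilinPoly b) {h} → Interpolates P h →
               (∀ i → h (e i) - h (replicate b false) ≤ - 1ℚ) → levelSum 1 P ≤ - ℕ→ℚ b
levelSum-1-≤ {zero}  P P≈h Δ≤-1 = ≤-refl
levelSum-1-≤ {suc b} P P≈h Δ≤-1 = begin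
  levelSum 1 P                                          ≡⟨⟩
  levelSum 1 (restrict₀ P) + levelSum 0 (derivative₀ P) ≤⟨ +-mono-≤ ih first-difference ⟩
  - ℕ→ℚ b + - 1ℚ                                        ≡⟨ neg-distrib-+ (ℕ→ℚ b) 1ℚ ⟨
  - (ℕ→ℚ b + 1ℚ)                                        ≡⟨ cong -_ (+-comm (ℕ→ℚ b) 1ℚ) ⟩
  - (1ℚ + ℕ→ℚ b)                                        ≡⟨ cong -_ (ℕ→ℚ-+ 1 b) ⟨
  - ℕ→ℚ (suc b)                                         ∎
  where
  open ≤-Reasoning
  ih : levelSum 1 (restrict₀ P) ≤ - ℕ→ℚ b
  ih = levelSum-1-≤ (restrict₀ P) (interpolates-restrict₀ P P≈h) (λ i → Δ≤-1 (fsuc i))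
  first-difference : levelSum 0 (derivative₀ P) ≤ - 1ℚ
  first-difference = ≤-trans (≤-reflexive (levelSum-0 (derivative₀ P) (interpolates-derivative₀ P P≈h)))
                             (Δ≤-1 fzero)

levelSum-2-≤ : ∀ {b} (P : MultilinPoly b) {h} → Interpolates P h →
               h (replicate b false) ≡ 0ℚ → (∀ i → h (e i) ≡ 1ℚ) → (∀ x → h x ≤ 1ℚ) →
               levelSum 2 P ≤ - ℕ→ℚ (b C 2)
levelSum-2-≤ {zero}  P P≈h h0≡0 he≡1 h≤1 = ≤-refl
levelSum-2-≤ {suc b} P {h} P≈h h0≡0 he≡1 h≤1 = begin
  levelSum 2 P                                           ≡⟨⟩
  levelSum 2 (restrict₀ P) + levelSum 1 (derivative₀ P)  ≤⟨ +-mono-≤ ih first-differences ⟩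
  - ℕ→ℚ (b C 2) + - ℕ→ℚ b                                ≡⟨ neg-distrib-+ (ℕ→ℚ (b C 2)) (ℕ→ℚ b) ⟨
  - (ℕ→ℚ (b C 2) + ℕ→ℚ b)                                ≡⟨ cong -_ (ℕ→ℚ-+ (b C 2) b) ⟨
  - ℕ→ℚ (b C 2 ℕ.+ b)                                    ≡⟨ cong (λ n → - ℕ→ℚ n) pascal ⟩
  - ℕ→ℚ (suc b C 2)                                      ∎
  where
  open ≤-Reasoning
  ih : levelSum 2 (restrict₀ P) ≤ - ℕ→ℚ (b C 2)
  ih = levelSum-2-≤ (restrict₀ P) (interpolates-restrict₀ P P≈h)
                    h0≡0 (λ i → he≡1 (fsuc i)) (λ x → h≤1 (false ∷ x))
  pascal : b C 2 ℕ.+ b ≡ suc b C 2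
  pascal = trans (ℕₚ.+-comm (b C 2) b) (sym (nC2-suc b))
  0̄ : Vec Bool b
  0̄ = replicate b false
  second-difference : ∀ i → (h (true ∷ e i) - h (false ∷ e i)) - (h (true ∷ 0̄) - h (false ∷ 0̄)) ≤ - 1ℚ
  second-difference i = begin
    (h (true ∷ e i) - h (false ∷ e i)) - (h (true ∷ 0̄) - h (false ∷ 0̄))
      ≡⟨ cong₂ (λ p q → (h (true ∷ e i) - p) - q) (he≡1 (fsuc i)) (cong₂ _-_ (he≡1 fzero) h0≡0) ⟩
    (h (true ∷ e i) - 1ℚ) - (1ℚ - 0ℚ)
      ≤⟨ +-monoˡ-≤ (- (1ℚ - 0ℚ)) (+-monoˡ-≤ (- 1ℚ) (h≤1 (true ∷ e i))) ⟩
    (1ℚ - 1ℚ) - (1ℚ - 0ℚ)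
      ≡⟨⟩
    - 1ℚ ∎
  first-differences : levelSum 1 (derivative₀ P) ≤ - ℕ→ℚ b
  first-differences = levelSum-1-≤ (derivative₀ P) (interpolates-derivative₀ P P≈h) second-difference

n*[n∸1]≡nC2+nC2 : ∀ n → n ℕ.* (n ℕ.∸ 1) ≡ n C 2 ℕ.+ n C 2
n*[n∸1]≡nC2+nC2 zero          = refl
n*[n∸1]≡nC2+nC2 (suc zero)    = refl
n*[n∸1]≡nC2+nC2 (suc (suc n)) = begin
  (2 ℕ.+ n) ℕ.* (1 ℕ.+ n)              ≡⟨ expand n ⟩
  (1 ℕ.+ n) ℕ.* n ℕ.+ 2 ℕ.* (1 ℕ.+ n)  ≡⟨ cong (ℕ._+ 2 ℕ.* (1 ℕ.+ n)) (n*[n∸1]≡nC2+nC2 (suc n)) ⟩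
  (k ℕ.+ k) ℕ.+ 2 ℕ.* (1 ℕ.+ n)        ≡⟨ regroup k (1 ℕ.+ n) ⟩
  (suc n ℕ.+ k) ℕ.+ (suc n ℕ.+ k)      ≡⟨ cong₂ ℕ._+_ (nC2-suc (suc n)) (nC2-suc (suc n)) ⟨
  suc (suc n) C 2 ℕ.+ suc (suc n) C 2  ∎
  where
  open ≡-Reasoning
  k : ℕ
  k = suc n C 2
  expand : ∀ n → (2 ℕ.+ n) ℕ.* (1 ℕ.+ n) ≡ (1 ℕ.+ n) ℕ.* n ℕ.+ 2 ℕ.* (1 ℕ.+ n)
  expand = ℕ-Solver.solve-∀
  regroup : ∀ t m → (t ℕ.+ t) ℕ.+ 2 ℕ.* m ≡ (m ℕ.+ t) ℕ.+ (m ℕ.+ t)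
  regroup = ℕ-Solver.solve-∀

second-derivative-at-0 : ∀ as → evalPoly (deriv (deriv as)) 0ℚ ≡ ℕ→ℚ 2 * coeff as 2
second-derivative-at-0 []               = sym (*-zeroʳ (ℕ→ℚ 2))
second-derivative-at-0 (_ ∷ [])         = sym (*-zeroʳ (ℕ→ℚ 2))
second-derivative-at-0 (_ ∷ _ ∷ [])     = sym (*-zeroʳ (ℕ→ℚ 2))
second-derivative-at-0 (_ ∷ _ ∷ c ∷ cs) = begin
  1ℚ * (ℕ→ℚ 2 * c) + 0ℚ * rest  ≡⟨ cong₂ _+_ (*-identityˡ (ℕ→ℚ 2 * c)) (*-zeroˡ rest) ⟩
  ℕ→ℚ 2 * c + 0ℚ                ≡⟨ +-identityʳ (ℕ→ℚ 2 * c) ⟩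
  ℕ→ℚ 2 * c                     ∎
  where
  open ≡-Reasoning
  rest : ℚ
  rest = evalPoly (derivFrom 2 (derivFrom 3 cs)) 0ℚ

n[n∸1]≤∣evalPoly″0∣ : ∀ n as → coeff as 2 ≤ - ℕ→ℚ (n C 2) →
                      ℕ→ℚ (n ℕ.* (n ℕ.∸ 1)) ≤ ∣ evalPoly (deriv (deriv as)) 0ℚ ∣
n[n∸1]≤∣evalPoly″0∣ n as c₂≤-t = begin
  ℕ→ℚ (n ℕ.* (n ℕ.∸ 1))               ≡⟨ cong ℕ→ℚ (n*[n∸1]≡nC2+nC2 n) ⟩
  ℕ→ℚ (t ℕ.+ t)                       ≡⟨ ℕ→ℚ-+ t t ⟩
  ℕ→ℚ t + ℕ→ℚ t                       ≤⟨ +-mono-≤ t≤-c₂ t≤-c₂ ⟩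
  - c₂ + - c₂                         ≡⟨ double c₂ ⟩
  - (ℕ→ℚ 2 * c₂)                      ≤⟨ p≤∣p∣ (- (ℕ→ℚ 2 * c₂)) ⟩
  ∣ - (ℕ→ℚ 2 * c₂) ∣                  ≡⟨ ∣-p∣≡∣p∣ (ℕ→ℚ 2 * c₂) ⟩
  ∣ ℕ→ℚ 2 * c₂ ∣                      ≡⟨ cong ∣_∣ (second-derivative-at-0 as) ⟨
  ∣ evalPoly (deriv (deriv as)) 0ℚ ∣  ∎
  where
  open ≤-Reasoning
  t : ℕ
  t = n C 2
  c₂ : ℚ
  c₂ = coeff as 2
  t≤-c₂ : ℕ→ℚ t ≤ - c₂
  t≤-c₂ = ≤-trans (≤-reflexive (sym (⁻¹-involutive (ℕ→ℚ t)))) (neg-antimono-≤ c₂≤-t)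
  double : ∀ c → - c + - c ≡ - ((1ℚ + 1ℚ) * c)
  double = solve 1 (λ c → (:- c) :+ (:- c) := :- ((con 1ℚ :+ con 1ℚ) :* c)) refl

diag-coeff₂≤ : ∀ {b} (P : MultilinPoly b) {h} → Interpolates P h →
               h (replicate b false) ≡ 0ℚ → (∀ i → h (e i) ≡ 1ℚ) → (∀ x → h x ≤ 1ℚ) →
               ∀ as → (∀ μ → diag P μ ≡ evalPoly as μ) → coeff as 2 ≤ - ℕ→ℚ (b C 2)
diag-coeff₂≤ {b} P P≈h h0≡0 he≡1 h≤1 as diag≗as = begin
  coeff as 2              ≡⟨ coeff-unique as (diagCoeffs P) as≗diagCoeffs 2 ⟩
  coeff (diagCoeffs P) 2  ≡⟨ coeff-diagCoeffs P 2 ⟩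
  levelSum 2 P            ≤⟨ levelSum-2-≤ P P≈h h0≡0 he≡1 h≤1 ⟩
  - ℕ→ℚ (b C 2)           ∎
  where
  open ≤-Reasoning
  as≗diagCoeffs : ∀ μ → evalPoly as μ ≡ evalPoly (diagCoeffs P) μ
  as≗diagCoeffs μ = trans (sym (diag≗as μ)) (diag≡evalPoly-diagCoeffs P μ)

∣diag∣≤1 : ∀ {b} (P : MultilinPoly b) {h} → Interpolates P h → (∀ x → h x ∈[0,1]) →
           ∀ x → 0ℚ ≤ x → x ≤ 1ℚ → ∣ diag P x ∣ ≤ 1ℚ
∣diag∣≤1 {b} P P≈h h∈ x 0≤x x≤1 = ≤-trans (≤-reflexive (0≤p⇒∣p∣≡p (proj₁ diag∈))) (proj₂ diag∈)
  where
  diag∈ : diag P x ∈[0,1]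
  diag∈ = evalML-∈[0,1] {P = P} P≈h h∈ (replicate⁺ b (0≤x , x≤1))

lemma11 : (b : ℕ) → 1 ℕ.≤ b → (f : Vec Bool b → Bool)
    → f (replicate b false) ≡ false
    → (∀ (i : Fin b) → f (e i) ≡ true)
    → (P : MultilinPoly b) → Represents P f
    → (Σ (Vec ℚ (ℕ.suc (degML P))) (λ a → ∀ μ → diag P μ ≡ evalPoly (toList a) μ))
      × (∀ (x : ℚ) → 0ℚ ℚ.≤ x → x ℚ.≤ 1ℚ → ∣ diag P x ∣ ℚ.≤ 1ℚ)
      × (∀ (a : List ℚ) → (∀ μ → diag P μ ≡ evalPoly a μ)
          → ℕ→ℚ (b ℕ.* (b ℕ.∸ 1)) ℚ.≤ ∣ evalPoly (deriv (deriv a)) 0ℚ ∣)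
-- For b = 0 the bound in (3) is trivial.
lemma11 b _ f f0≡false fe≡true P P≈f =
    diag-degree P
  , ∣diag∣≤1 P P≈f f∈[0,1]
  , λ as diag≗as → n[n∸1]≤∣evalPoly″0∣ b as (diag-coeff₂≤ P P≈f f0≡0 fe≡1 f≤1 as diag≗as)
  where
  f∈[0,1] : ∀ x → B→ℚ (f x) ∈[0,1]
  f∈[0,1] x = B→ℚ-∈[0,1] (f x)
  f0≡0 : B→ℚ (f (replicate b false)) ≡ 0ℚ
  f0≡0 = cong B→ℚ f0≡false
  fe≡1 : ∀ i → B→ℚ (f (e i)) ≡ 1ℚ
  fe≡1 i = cong B→ℚ (fe≡true i)
  f≤1 : ∀ x → B→ℚ (f x) ≤ 1ℚ
  f≤1 x = proj₂ (f∈[0,1] x)
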